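{- Let $c\in\mathcal{C}_X$ and let $s$ be any color in the range of $c$. If $(v_i,x_j)$ and $(v_{i'},x_{j'})$ are distinct vertices in $c^{ -1}(s)$, then $i\ne i'$ and $j\ne j'$. Consequently $|c^{ -1}(s)|\le n$.
   Context: Standing setting: $n,a$ are integers with $2\le n\le a$; $M=K_n$ with $V(M)=\{v_1,\dots,v_n\}$; $K_{a,b}$ has partite sets $X=\{x_1,\dots,x_a\}$ and $Y=\{y_1,\dots,y_b\}$ with $b=\left(\prod_{i=0}^{n-1}(n+a-1-i)\right)^a-1$; $H=M\square K_{a,b}$ (Cartesian product: $(u,v)\sim(u',v')$ iff $u=u'$ and $vv'\in E(K_{a,b})$, or $v=v'$ and $uu'\in E(M)$). $L$ is an $(n+a-1)$-assignment for $H$ (each vertex gets a list of $n+a-1$ colors) such that for each $i\in[n]$ the lists $L(v_i,x_1),\dots,L(v_i,x_a)$ are pairwise disjoint. $H_X$ is the subgraph of $H$ induced by $\{(v_i,x_j): i\in[n],j\in[a]\}$ (so $(v_i,x_j)\sim(v_{i'},x_{j'})$ in $H_X$ iff $j=j'$ and $i\neq i'$), $L_X$ is the restriction of $L$ to $V(H_X)$, and $\mathcal{C}_X$ is the set of all proper $L_X$-colorings of $H_X$ (proper colorings $c$ with $c(v)\in L(v)$ for all $v$). -}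

module Defs where

open import Data.Nat using (ℕ; zero; suc; _+_; _*_; _∸_; _^_; _≤_)
open import Data.Nat.Properties using (_≟_)
open import Data.Fin using (Fin)
open import Data.Sum using (_⊎_; inj₁; inj₂)
open import Data.Product using (_×_; _,_; proj₁; proj₂; Σ)
open import Data.List using (List; length; allFin; cartesianProduct; filter)
open import Data.List.Membership.Propositional using (_∈_)
open import Data.List.Relation.Unary.Unique.Propositional using (Unique)
open import Relation.Binary.PropositionalEquality using (_≡_; _≢_)
open import Relation.Nullary using (¬_)
open import Data.Empty using (⊥)

Color : Set
Color = ℕ

fallProd : ℕ → ℕ → ℕ
fallProd m zero    = 1
fallProd m (suc k) = fallProd m k * (m ∸ k)

bSize : ℕ → ℕ → ℕ
bSize n a = (fallProd (n + a ∸ 1) n) ^ a ∸ 1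

-- Vertices of H = K_n □ K_{a,b}: (v_i , x_j) is (i , inj₁ j), (v_i , y_k) is (i , inj₂ k).
VertexH : ℕ → ℕ → Set
VertexH n a = Fin n × (Fin a ⊎ Fin (bSize n a))

IsAssignment : (n a : ℕ) → (VertexH n a → List Color) → Set
IsAssignment n a L =
  (v : VertexH n a) → Unique (L v) × length (L v) ≡ n + a ∸ 1

XListsDisjoint : (n a : ℕ) → (VertexH n a → List Color) → Set
XListsDisjoint n a L =
  (i : Fin n) (j j' : Fin a) → j ≢ j' →
  (col : Color) → col ∈ L (i , inj₁ j) → col ∈ L (i , inj₁ j') → ⊥

-- Vertices of H_X: (v_i, x_j) is (i , j).  Adjacent iff j = j' and i ≠ i'.
-- A coloring c of H_X is a proper L_X-coloring (c ∈ 𝒞_X).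
IsProperLXColoring : (n a : ℕ) → (VertexH n a → List Color) →
                     (Fin n → Fin a → Color) → Set
IsProperLXColoring n a L c =
  ((i : Fin n) (j : Fin a) → c i j ∈ L (i , inj₁ j)) ×
  ((i i' : Fin n) (j : Fin a) → i ≢ i' → c i j ≢ c i' j)

InRange : (n a : ℕ) → (Fin n → Fin a → Color) → Color → Set
InRange n a c s = Σ (Fin n) λ i → Σ (Fin a) λ j → c i j ≡ s

preimageCard : (n a : ℕ) → (Fin n → Fin a → Color) → Color → ℕ
preimageCard n a c s =
  length (filter (λ p → c (proj₁ p) (proj₂ p) ≟ s)
                 (cartesianProduct (allFin n) (allFin a)))

{-# OPTIONS --safe #-}
module Submission where

-- Within the row of v_i the lists L(v_i, x_j) are pairwise disjoint, so c takes
-- distinct values on a row; within the column of x_j the vertices form a copy of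
-- K_n in H_X, so the proper colouring c takes distinct values on a column. Hence
-- a colour class meets each of the n rows at most once.

open import Defs
open import Level using (Level)
open import Data.Nat using (ℕ; _≤_)
open import Data.Fin using (Fin; zero; suc)
open import Data.Fin.Properties using (injective⇒≤)
open import Data.Sum using (inj₁)
open import Data.Product using (_×_; _,_; proj₁; proj₂)
open import Data.List using (List; length; lookup; map; filter)
open import Data.List.Properties using (length-map)
open import Data.List.Membership.Propositional using (_∈_)
open import Data.List.Membership.Propositional.Properties using (∈-lookup)
open import Data.List.Relation.Unary.All as All using (All; []; _∷_)
open import Data.List.Relation.Unary.All.Properties using (all-filter)
open import Data.List.Relation.Unary.AllPairs using (AllPairs; []; _∷_)
open import Data.List.Relation.Unary.AllPairs.Properties using (map⁺)
open import Data.List.Relation.Unary.Unique.Propositional using (Unique)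
import Data.List.Relation.Unary.Unique.Propositional.Properties as Unique
open import Data.Nat.Properties using (_≟_)
open import Function using (_on_)
open import Relation.Binary.Core using (Rel)
open import Relation.Binary.PropositionalEquality using (_≡_; _≢_; refl; sym; trans; cong; subst)
open import Relation.Nullary using (contradiction)
open import Relation.Unary using (Pred; Decidable)

private
  variable
    ℓ p r q : Level
    A : Set ℓ

lookup-injective : {xs : List A} → Unique xs → ∀ i j → lookup xs i ≡ lookup xs j → i ≡ j
lookup-injective (_ ∷ _)     zero    zero    _  = refl
lookup-injective (x∉ ∷ _)    zero    (suc j) eq = contradiction eq (All.lookup x∉ (∈-lookup j))
lookup-injective (x∉ ∷ _)    (suc i) zero    eq = contradiction (sym eq) (All.lookup x∉ (∈-lookup i))
lookup-injective (_ ∷ uniq)  (suc i) (suc j) eq = cong suc (lookup-injective uniq i j eq)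

Unique⇒length≤ : ∀ {n} {xs : List (Fin n)} → Unique xs → length xs ≤ n
Unique⇒length≤ {xs = xs} uniq = injective⇒≤ {f = lookup xs} (lookup-injective uniq _ _)

AllPairs-restrict : {P : Pred A p} {R : Rel A r} {S : Rel A q} →
                    (∀ {x y} → P x → P y → R x y → S x y) →
                    {xs : List A} → All P xs → AllPairs R xs → AllPairs S xs
AllPairs-restrict weaken []         []         = []
AllPairs-restrict weaken (px ∷ pxs) (rx ∷ rxs) =
  All.zipWith (λ (py , rxy) → weaken px py rxy) (pxs , rx) ∷ AllPairs-restrict weaken pxs rxs

length-filter≤ : ∀ {n} {P : Pred A p} (P? : Decidable P) (f : A → Fin n) →
                 (∀ {x y} → P x → P y → x ≢ y → f x ≢ f y) →
                 {xs : List A} → Unique xs → length (filter P? xs) ≤ n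
length-filter≤ {A = A} {n = n} P? f f-injectiveOnP {xs} uniq =
  subst (_≤ n) (length-map f ys) (Unique⇒length≤ (map⁺ distinct-images))
  where
  ys : List A
  ys = filter P? xs
  distinct-images : AllPairs (_≢_ on f) ys
  distinct-images = AllPairs-restrict f-injectiveOnP (all-filter P? xs) (Unique.filter⁺ P? uniq)

module _ {n a : ℕ} {L : VertexH n a → List Color} {c : Fin n → Fin a → Color} where

  row-injective : XListsDisjoint n a L → (∀ i j → c i j ∈ L (i , inj₁ j)) →
                  ∀ i {j j'} → j ≢ j' → c i j ≢ c i j'
  row-injective disjoint c∈L i {j} {j'} j≢j' eq =
    disjoint i j j' j≢j' (c i j) (c∈L i j) (subst (_∈ L (i , inj₁ j')) (sym eq) (c∈L i j'))

  monochromatic⇒distinct-rows-columns :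
    XListsDisjoint n a L → IsProperLXColoring n a L c →
    ∀ {s} i i' j j' → (i , j) ≢ (i' , j') → c i j ≡ s → c i' j' ≡ s → (i ≢ i') × (j ≢ j')
  monochromatic⇒distinct-rows-columns disjoint (c∈L , proper) i i' j j' ij≢i'j' cij≡s ci'j'≡s =
    same-row-impossible , same-column-impossible
    where
    same-colour : c i j ≡ c i' j'
    same-colour = trans cij≡s (sym ci'j'≡s)
    same-row-impossible : i ≢ i'
    same-row-impossible refl =
      row-injective disjoint c∈L i (λ { refl → ij≢i'j' refl }) same-colour
    same-column-impossible : j ≢ j'
    same-column-impossible refl = proper i i' j (λ { refl → ij≢i'j' refl }) same-colour

lemma15 : (n a : ℕ) → 2 ≤ n → n ≤ a →
    (L : VertexH n a → List Color) → IsAssignment n a L → XListsDisjoint n a L →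
    (c : Fin n → Fin a → Color) → IsProperLXColoring n a L c →
    (s : Color) → InRange n a c s →
    ((i i' : Fin n) (j j' : Fin a) → (i , j) ≢ (i' , j') →
       c i j ≡ s → c i' j' ≡ s → (i ≢ i') × (j ≢ j'))
    × (preimageCard n a c s ≤ n)
lemma15 n a _ _ L _ disjoint c proper s _ = distinct , card≤n
  where
  distinct : (i i' : Fin n) (j j' : Fin a) → (i , j) ≢ (i' , j') →
             c i j ≡ s → c i' j' ≡ s → (i ≢ i') × (j ≢ j')
  distinct = monochromatic⇒distinct-rows-columns {L = L} {c = c} disjoint proper
  card≤n : preimageCard n a c s ≤ n
  card≤n = length-filter≤ (λ v → c (proj₁ v) (proj₂ v) ≟ s) proj₁
    (λ { {i , j} {i' , j'} cij≡s ci'j'≡s ij≢i'j' → proj₁ (distinct i i' j j' ij≢i'j' cij≡s ci'j'≡s) })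
    (Unique.cartesianProduct⁺ (Unique.allFin⁺ n) (Unique.allFin⁺ a))
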